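{- Let $M$ be a matroid on an $n$-element ground set $E$. Then for $0\le i\le n$, \[P_{M,i}(Z)=\sum_{j=n-i}^{n}(-1)^{i+j+n}\binom{j}{n-i}\sum_{\gamma\subseteq E,\,|\gamma|=j}Z^{n_{M}(E\smallsetminus \gamma)}.\]
   Context: For a matroid $M$ on $E$ with rank function $r_M$, the nullity is $n_M(\sigma)=|\sigma|-r_M(\sigma)$. Generalized weight polynomials: $P_{M,0}(Z)=1$ and, for $1\le j\le n$, $P_{M,j}(Z)=(-1)^j\sum_{\sigma\subseteq E,\,|\sigma|=j}\sum_{\gamma\subseteq\sigma}(-1)^{|\gamma|}Z^{n_M(\gamma)}$. -}

module Defs where

open import Data.Nat as ℕ using (ℕ; zero; suc; _≤_; _∸_)
open import Data.Nat.Combinatorics using (_C_)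
open import Data.Integer as ℤ using (ℤ; +_; -_)
open import Data.Bool using (Bool; true; false)
open import Data.Vec using (_∷_; [])
open import Data.List using (List; []; _∷_; map; _++_; filter; applyUpTo)
open import Data.Fin.Subset using (Subset; _⊆_; _∪_; _∩_; ∁; ∣_∣; ⊥)
open import Data.Fin.Subset.Properties using (_⊆?_)
open import Relation.Nullary.Decidable using (⌊_⌋)
open import Relation.Binary.PropositionalEquality using (_≡_)

record Matroid (n : ℕ) : Set where
  field
    rank      : Subset n → ℕ
    rank-≤    : ∀ σ → rank σ ≤ ∣ σ ∣
    rank-mono : ∀ σ τ → σ ⊆ τ → rank σ ≤ rank τ
    rank-sub  : ∀ σ τ → rank (σ ∪ τ) ℕ.+ rank (σ ∩ τ)
                        ≤ rank σ ℕ.+ rank τ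

open Matroid public

-- nullity n_M(σ) = |σ| - r_M(σ)  (truncated subtraction is exact by R1)
nullity : ∀ {n} → Matroid n → Subset n → ℕ
nullity M σ = ∣ σ ∣ ∸ rank M σ

Poly : Set
Poly = ℕ → ℤ

_≈ₚ_ : Poly → Poly → Set
p ≈ₚ q = ∀ d → p d ≡ q d

0ₚ : Poly
0ₚ _ = + 0

1ₚ : Poly
1ₚ zero    = + 1
1ₚ (suc _) = + 0

Z^ : ℕ → Poly
Z^ k d with ⌊ k ℕ.≟ d ⌋
... | true  = + 1
... | false = + 0

_+ₚ_ : Poly → Poly → Poly
(p +ₚ q) d = p d ℤ.+ q d

_·ₚ_ : ℤ → Poly → Poly
(c ·ₚ p) d = c ℤ.* p d

sumₚ : List Poly → Poly
sumₚ []       = 0ₚ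
sumₚ (p ∷ ps) = p +ₚ sumₚ ps

sgn : ℕ → ℤ
sgn zero    = + 1
sgn (suc k) = - sgn k

allSubsets : (n : ℕ) → List (Subset n)
allSubsets zero    = [] ∷ []
allSubsets (suc n) = map (false ∷_) (allSubsets n) ++ map (true ∷_) (allSubsets n)

subsetsOf : ∀ {n} → Subset n → List (Subset n)
subsetsOf {n} σ = filter (λ γ → γ ⊆? σ) (allSubsets n)

subsetsOfSize : (n j : ℕ) → List (Subset n)
subsetsOfSize n j = filter (λ σ → ∣ σ ∣ ℕ.≟ j) (allSubsets n)

P : ∀ {n} → Matroid n → ℕ → Poly
P M zero    = 1ₚ
P {n} M (suc j) =
  sgn (suc j) ·ₚ sumₚ (map (λ σ → sumₚ (map (λ γ → sgn ∣ γ ∣ ·ₚ Z^ (nullity M γ))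
                                         (subsetsOf σ)))
                          (subsetsOfSize n (suc j)))

RHS : ∀ {n} → Matroid n → ℕ → Poly
RHS {n} M i =
  sumₚ (map (λ j → (sgn (i ℕ.+ j ℕ.+ n) ℤ.* + (j C (n ∸ i)))
                   ·ₚ sumₚ (map (λ γ → Z^ (nullity M (∁ γ))) (subsetsOfSize n j)))
            (applyUpTo (λ k → (n ∸ i) ℕ.+ k) (suc i)))

module Submission where

-- The identity is proved one coefficient of Z at a time.  Writing
-- g(γ) = (-1)^{|γ|} [Z^d] Z^{n_M(γ)}, the d-th coefficient of P_{M,i} is
--   (-1)^i Σ_{|σ|=i} Σ_{γ⊆σ} g(γ) = (-1)^i Σ_γ #{σ ⊇ γ : |σ| = i} · g(γ),
-- after exchanging the two sums.  Passing to complements, the supersets of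
-- γ of size i correspond to the subsets of E∖γ of size n-i, so their number
-- is C(|E∖γ|, n-i).  On the other side, exchanging sums in the right-hand
-- side and reindexing γ ↦ E∖γ produces Σ_γ (-1)^{i+|E∖γ|+n} C(|E∖γ|, n-i)
-- [Z^d] Z^{n_M(γ)}: the range j ≥ n-i is harmless because C(j, n-i) vanishes
-- below it.  The two sums agree termwise since (-1)^{i+|E∖γ|+n} = (-1)^{i+|γ|}.

open import Defs
open import Data.Nat using (ℕ; _≤_)

open import Data.Nat as ℕ using (zero; suc; _∸_; _<_; _<?_; _≟_)
import Data.Nat.Properties as ℕP
open import Data.Nat.Combinatorics using (_C_; nCk+nC[k+1]≡[n+1]C[k+1]; k>n⇒nCk≡0)
import Data.Nat.Tactic.RingSolver as ℕSolver
open import Data.Integer as ℤ using (ℤ; +_; -_)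
import Data.Integer.Properties as ℤP
open import Algebra.Properties.CommutativeSemigroup ℤP.+-commutativeSemigroup
  using () renaming (interchange to +-interchange)
import Data.Integer.Tactic.RingSolver as ℤSolver
open import Data.Bool using (true; false; if_then_else_)
open import Data.Vec using (_∷_; [])
open import Data.List using (List; []; _∷_; map; _++_; filter; applyUpTo; _∷ʳ_)
open import Data.List.Properties using (applyUpTo-∷ʳ)
open import Data.Fin.Subset using (Subset; ∁; ∣_∣; ⊥)
open import Data.Fin.Subset.Properties
  using (_⊆?_; ∣p∣≤n; ∣⊥∣≡0; ∣∁p∣≡n∸∣p∣; p⊆q⇒∁p⊇∁q; ∁p⊆∁q⇒p⊇q; ∪-∩-booleanAlgebra)
import Algebra.Lattice.Properties.BooleanAlgebra as BooleanAlgebraProperties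
open import Relation.Nullary using (Dec; does; yes; no; ¬_)
open import Relation.Unary using (Pred; Decidable)
open import Relation.Binary.PropositionalEquality
open import Relation.Binary.Definitions using (tri<; tri≈; tri>)
open import Data.Empty using (⊥-elim)
open import Function using (_∘_)
open ≡-Reasoning

∑ : ∀ {A : Set} → List A → (A → ℤ) → ℤ
∑ []       f = + 0
∑ (x ∷ xs) f = f x ℤ.+ ∑ xs f

∑-cong : ∀ {A : Set} xs {f g : A → ℤ} → (∀ x → f x ≡ g x) → ∑ xs f ≡ ∑ xs g
∑-cong []       f≗g = refl
∑-cong (x ∷ xs) f≗g = cong₂ ℤ._+_ (f≗g x) (∑-cong xs f≗g)

∑-zero : ∀ {A : Set} xs {f : A → ℤ} → (∀ x → f x ≡ + 0) → ∑ xs f ≡ + 0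
∑-zero []       f≗0 = refl
∑-zero (x ∷ xs) f≗0 = cong₂ ℤ._+_ (f≗0 x) (∑-zero xs f≗0)

∑-+ : ∀ {A : Set} xs (f g : A → ℤ) → ∑ xs (λ x → f x ℤ.+ g x) ≡ ∑ xs f ℤ.+ ∑ xs g
∑-+ []       f g = refl
∑-+ (x ∷ xs) f g = trans (cong (ℤ._+_ (f x ℤ.+ g x)) (∑-+ xs f g))
                         (+-interchange (f x) (g x) (∑ xs f) (∑ xs g))

∑-*ˡ : ∀ {A : Set} xs c (f : A → ℤ) → ∑ xs (λ x → c ℤ.* f x) ≡ c ℤ.* ∑ xs f
∑-*ˡ []       c f = sym (ℤP.*-zeroʳ c)
∑-*ˡ (x ∷ xs) c f = trans (cong (ℤ._+_ (c ℤ.* f x)) (∑-*ˡ xs c f))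
                          (sym (ℤP.*-distribˡ-+ c (f x) (∑ xs f)))

∑-*ʳ : ∀ {A : Set} xs (f : A → ℤ) c → ∑ xs (λ x → f x ℤ.* c) ≡ ∑ xs f ℤ.* c
∑-*ʳ xs f c = begin
  ∑ xs (λ x → f x ℤ.* c) ≡⟨ ∑-cong xs (λ x → ℤP.*-comm (f x) c) ⟩
  ∑ xs (λ x → c ℤ.* f x) ≡⟨ ∑-*ˡ xs c f ⟩
  c ℤ.* ∑ xs f           ≡⟨ ℤP.*-comm c _ ⟩
  ∑ xs f ℤ.* c           ∎

∑-swap : ∀ {A B : Set} xs ys (h : A → B → ℤ) →
         ∑ xs (λ x → ∑ ys (h x)) ≡ ∑ ys (λ y → ∑ xs (λ x → h x y))
∑-swap []       ys h = sym (∑-zero ys (λ _ → refl))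
∑-swap (x ∷ xs) ys h = begin
  ∑ ys (h x) ℤ.+ ∑ xs (λ x′ → ∑ ys (h x′))           ≡⟨ cong (ℤ._+_ (∑ ys (h x))) (∑-swap xs ys h) ⟩
  ∑ ys (h x) ℤ.+ ∑ ys (λ y → ∑ xs (λ x′ → h x′ y))   ≡⟨ ∑-+ ys (h x) _ ⟨
  ∑ ys (λ y → h x y ℤ.+ ∑ xs (λ x′ → h x′ y))        ∎

-- Fubini for a weighted double sum; this is the shape in which both sides
-- of the proposition present themselves.
∑-exchange : ∀ {A B : Set} xs ys (a : A → ℤ) (b : A → B → ℤ) (f : B → ℤ) →
             ∑ xs (λ x → a x ℤ.* ∑ ys (λ y → b x y ℤ.* f y))
             ≡ ∑ ys (λ y → ∑ xs (λ x → a x ℤ.* b x y) ℤ.* f y)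
∑-exchange xs ys a b f = begin
  ∑ xs (λ x → a x ℤ.* ∑ ys (λ y → b x y ℤ.* f y))
    ≡⟨ ∑-cong xs (λ x → sym (∑-*ˡ ys (a x) _)) ⟩
  ∑ xs (λ x → ∑ ys (λ y → a x ℤ.* (b x y ℤ.* f y)))
    ≡⟨ ∑-swap xs ys _ ⟩
  ∑ ys (λ y → ∑ xs (λ x → a x ℤ.* (b x y ℤ.* f y)))
    ≡⟨ ∑-cong ys (λ y → ∑-cong xs (λ x → sym (ℤP.*-assoc (a x) (b x y) (f y)))) ⟩
  ∑ ys (λ y → ∑ xs (λ x → a x ℤ.* b x y ℤ.* f y))
    ≡⟨ ∑-cong ys (λ y → ∑-*ʳ xs (λ x → a x ℤ.* b x y) (f y)) ⟩
  ∑ ys (λ y → ∑ xs (λ x → a x ℤ.* b x y) ℤ.* f y) ∎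

∑-++ : ∀ {A : Set} xs ys (f : A → ℤ) → ∑ (xs ++ ys) f ≡ ∑ xs f ℤ.+ ∑ ys f
∑-++ []       ys f = sym (ℤP.+-identityˡ _)
∑-++ (x ∷ xs) ys f = trans (cong (ℤ._+_ (f x)) (∑-++ xs ys f)) (sym (ℤP.+-assoc (f x) _ _))

∑-∷ʳ : ∀ {A : Set} xs (x : A) f → ∑ (xs ∷ʳ x) f ≡ ∑ xs f ℤ.+ f x
∑-∷ʳ xs x f = trans (∑-++ xs (x ∷ []) f) (cong (ℤ._+_ (∑ xs f)) (ℤP.+-identityʳ (f x)))

∑-map : ∀ {A B : Set} (g : A → B) xs (f : B → ℤ) → ∑ (map g xs) f ≡ ∑ xs (f ∘ g)
∑-map g []       f = refl
∑-map g (x ∷ xs) f = cong (ℤ._+_ (f (g x))) (∑-map g xs f)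

𝟙 : ∀ {p} {P : Set p} → Dec P → ℤ
𝟙 p = if does p then + 1 else + 0

𝟙-yes : ∀ {p} {P : Set p} → P → (P? : Dec P) → 𝟙 P? ≡ + 1
𝟙-yes x (yes _) = refl
𝟙-yes x (no ¬x) = ⊥-elim (¬x x)

𝟙-no : ∀ {p} {P : Set p} → ¬ P → (P? : Dec P) → 𝟙 P? ≡ + 0
𝟙-no ¬x (yes x) = ⊥-elim (¬x x)
𝟙-no ¬x (no _)  = refl

𝟙-⇔ : ∀ {p q} {P : Set p} {Q : Set q} → (P → Q) → (Q → P) →
      (P? : Dec P) (Q? : Dec Q) → 𝟙 P? ≡ 𝟙 Q?
𝟙-⇔ to from (yes x) Q? = sym (𝟙-yes (to x) Q?)
𝟙-⇔ to from (no ¬x) Q? = sym (𝟙-no (¬x ∘ from) Q?)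

∑-filter : ∀ {A : Set} {p} {P : Pred A p} (P? : Decidable P) xs (f : A → ℤ) →
           ∑ (filter P? xs) f ≡ ∑ xs (λ x → 𝟙 (P? x) ℤ.* f x)
∑-filter P? []       f = refl
∑-filter P? (x ∷ xs) f with does (P? x)
... | false = trans (∑-filter P? xs f) (sym (ℤP.+-identityˡ _))
... | true  = cong₂ ℤ._+_ (sym (ℤP.*-identityˡ (f x))) (∑-filter P? xs f)

coeff-∑ : ∀ {A : Set} xs (F : A → Poly) d → sumₚ (map F xs) d ≡ ∑ xs (λ x → F x d)
coeff-∑ []       F d = refl
coeff-∑ (x ∷ xs) F d = cong (ℤ._+_ (F x d)) (coeff-∑ xs F d)

coeff-∑-filter : ∀ {A : Set} {p} {P : Pred A p} (P? : Decidable P) xs (F : A → Poly) d →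
                 sumₚ (map F (filter P? xs)) d ≡ ∑ xs (λ x → 𝟙 (P? x) ℤ.* F x d)
coeff-∑-filter P? xs F d = trans (coeff-∑ (filter P? xs) F d) (∑-filter P? xs (λ x → F x d))

∑-allSubsets-suc : ∀ n (f : Subset (suc n) → ℤ) →
  ∑ (allSubsets (suc n)) f
  ≡ ∑ (allSubsets n) (λ σ → f (false ∷ σ)) ℤ.+ ∑ (allSubsets n) (λ σ → f (true ∷ σ))
∑-allSubsets-suc n f = begin
  ∑ (map (false ∷_) (allSubsets n) ++ map (true ∷_) (allSubsets n)) f
    ≡⟨ ∑-++ (map (false ∷_) (allSubsets n)) _ f ⟩
  ∑ (map (false ∷_) (allSubsets n)) f ℤ.+ ∑ (map (true ∷_) (allSubsets n)) f
    ≡⟨ cong₂ ℤ._+_ (∑-map (false ∷_) (allSubsets n) f) (∑-map (true ∷_) (allSubsets n) f) ⟩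
  ∑ (allSubsets n) (λ σ → f (false ∷ σ)) ℤ.+ ∑ (allSubsets n) (λ σ → f (true ∷ σ)) ∎

∑-∁ : ∀ n (f : Subset n → ℤ) → ∑ (allSubsets n) (f ∘ ∁) ≡ ∑ (allSubsets n) f
∑-∁ zero    f = refl
∑-∁ (suc n) f = begin
  ∑ (allSubsets (suc n)) (f ∘ ∁)
    ≡⟨ ∑-allSubsets-suc n (f ∘ ∁) ⟩
  ∑ (allSubsets n) (λ σ → f (true ∷ ∁ σ)) ℤ.+ ∑ (allSubsets n) (λ σ → f (false ∷ ∁ σ))
    ≡⟨ cong₂ ℤ._+_ (∑-∁ n (λ σ → f (true ∷ σ))) (∑-∁ n (λ σ → f (false ∷ σ))) ⟩
  ∑ (allSubsets n) (λ σ → f (true ∷ σ)) ℤ.+ ∑ (allSubsets n) (λ σ → f (false ∷ σ))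
    ≡⟨ ℤP.+-comm (∑ (allSubsets n) (λ σ → f (true ∷ σ))) _ ⟩
  ∑ (allSubsets n) (λ σ → f (false ∷ σ)) ℤ.+ ∑ (allSubsets n) (λ σ → f (true ∷ σ))
    ≡⟨ ∑-allSubsets-suc n f ⟨
  ∑ (allSubsets (suc n)) f ∎

∁-involutive : ∀ {n} (σ : Subset n) → ∁ (∁ σ) ≡ σ
∁-involutive {n} = ¬-involutive
  where open BooleanAlgebraProperties (∪-∩-booleanAlgebra n)

∑-size-zero : ∀ n (f : Subset n → ℤ) → ∑ (allSubsets n) (λ σ → 𝟙 (∣ σ ∣ ≟ 0) ℤ.* f σ) ≡ f ⊥
∑-size-zero zero    f = trans (ℤP.+-identityʳ _) (ℤP.*-identityˡ _)
∑-size-zero (suc n) f =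
  trans (∑-allSubsets-suc n _)
        (trans (cong₂ ℤ._+_ (∑-size-zero n (λ σ → f (false ∷ σ))) (∑-zero (allSubsets n) (λ _ → refl)))
               (ℤP.+-identityʳ _))

∑-⊆⊥ : ∀ n (f : Subset n → ℤ) → ∑ (allSubsets n) (λ γ → 𝟙 (γ ⊆? ⊥) ℤ.* f γ) ≡ f ⊥
∑-⊆⊥ zero    f = trans (ℤP.+-identityʳ _) (ℤP.*-identityˡ _)
∑-⊆⊥ (suc n) f =
  trans (∑-allSubsets-suc n _)
        (trans (cong₂ ℤ._+_ (∑-⊆⊥ n (λ γ → f (false ∷ γ))) (∑-zero (allSubsets n) (λ _ → refl)))
               (ℤP.+-identityʳ _))

-- A set τ has exactly C(|τ|, k) subsets with k elements.  Induction on the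
-- first element: if it lies in τ, a k-subset either omits it or contains
-- it, and Pascal's rule adds up the two counts.
subsets-of-size : ∀ {n} (τ : Subset n) k →
  ∑ (allSubsets n) (λ ρ → 𝟙 (∣ ρ ∣ ≟ k) ℤ.* 𝟙 (ρ ⊆? τ)) ≡ + (∣ τ ∣ C k)
subsets-of-size []          zero    = refl
subsets-of-size []          (suc k) = refl
subsets-of-size {suc n} (false ∷ τ) k = begin
  ∑ (allSubsets (suc n)) (λ ρ → 𝟙 (∣ ρ ∣ ≟ k) ℤ.* 𝟙 (ρ ⊆? (false ∷ τ)))
    ≡⟨ ∑-allSubsets-suc n _ ⟩
  ∑ (allSubsets n) (λ ρ → 𝟙 (∣ ρ ∣ ≟ k) ℤ.* 𝟙 (ρ ⊆? τ))
    ℤ.+ ∑ (allSubsets n) (λ ρ → 𝟙 (suc ∣ ρ ∣ ≟ k) ℤ.* + 0)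
    ≡⟨ cong₂ ℤ._+_ (subsets-of-size τ k) (∑-zero (allSubsets n) (λ ρ → ℤP.*-zeroʳ (𝟙 (suc ∣ ρ ∣ ≟ k)))) ⟩
  + (∣ τ ∣ C k) ℤ.+ + 0
    ≡⟨ ℤP.+-identityʳ _ ⟩
  + (∣ τ ∣ C k) ∎
subsets-of-size {suc n} (true ∷ τ) zero = begin
  ∑ (allSubsets (suc n)) (λ ρ → 𝟙 (∣ ρ ∣ ≟ 0) ℤ.* 𝟙 (ρ ⊆? (true ∷ τ)))
    ≡⟨ ∑-allSubsets-suc n _ ⟩
  ∑ (allSubsets n) (λ ρ → 𝟙 (∣ ρ ∣ ≟ 0) ℤ.* 𝟙 (ρ ⊆? τ))
    ℤ.+ ∑ (allSubsets n) (λ ρ → + 0 ℤ.* 𝟙 (ρ ⊆? τ))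
    ≡⟨ cong₂ ℤ._+_ (subsets-of-size τ 0) (∑-zero (allSubsets n) (λ _ → refl)) ⟩
  + 1 ∎
subsets-of-size {suc n} (true ∷ τ) (suc k) = begin
  ∑ (allSubsets (suc n)) (λ ρ → 𝟙 (∣ ρ ∣ ≟ suc k) ℤ.* 𝟙 (ρ ⊆? (true ∷ τ)))
    ≡⟨ ∑-allSubsets-suc n _ ⟩
  ∑ (allSubsets n) (λ ρ → 𝟙 (∣ ρ ∣ ≟ suc k) ℤ.* 𝟙 (ρ ⊆? τ))
    ℤ.+ ∑ (allSubsets n) (λ ρ → 𝟙 (∣ ρ ∣ ≟ k) ℤ.* 𝟙 (ρ ⊆? τ))
    ≡⟨ cong₂ ℤ._+_ (subsets-of-size τ (suc k)) (subsets-of-size τ k) ⟩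
  + (∣ τ ∣ C suc k) ℤ.+ + (∣ τ ∣ C k)
    ≡⟨ ℤP.pos-+ (∣ τ ∣ C suc k) _ ⟨
  + (∣ τ ∣ C suc k ℕ.+ ∣ τ ∣ C k)
    ≡⟨ cong +_ (ℕP.+-comm (∣ τ ∣ C suc k) _) ⟩
  + (∣ τ ∣ C k ℕ.+ ∣ τ ∣ C suc k)
    ≡⟨ cong +_ (nCk+nC[k+1]≡[n+1]C[k+1] ∣ τ ∣ k) ⟩
  + (suc ∣ τ ∣ C suc k) ∎

-- Dually, γ has C(|E∖γ|, n-i) supersets with i elements: σ ↦ E∖σ maps
-- them bijectively onto the (n-i)-subsets of E∖γ.
supersets-of-size : ∀ {n} (γ : Subset n) i → i ≤ n →
  ∑ (allSubsets n) (λ σ → 𝟙 (∣ σ ∣ ≟ i) ℤ.* 𝟙 (γ ⊆? σ)) ≡ + (∣ ∁ γ ∣ C (n ∸ i))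
supersets-of-size {n} γ i i≤n = begin
  ∑ (allSubsets n) (λ σ → 𝟙 (∣ σ ∣ ≟ i) ℤ.* 𝟙 (γ ⊆? σ))
    ≡⟨ ∑-cong (allSubsets n) (λ σ → cong₂ ℤ._*_ (size-∁ σ) (inclusion-∁ σ)) ⟩
  ∑ (allSubsets n) (λ σ → 𝟙 (∣ ∁ σ ∣ ≟ n ∸ i) ℤ.* 𝟙 (∁ σ ⊆? ∁ γ))
    ≡⟨ ∑-∁ n (λ ρ → 𝟙 (∣ ρ ∣ ≟ n ∸ i) ℤ.* 𝟙 (ρ ⊆? ∁ γ)) ⟩
  ∑ (allSubsets n) (λ ρ → 𝟙 (∣ ρ ∣ ≟ n ∸ i) ℤ.* 𝟙 (ρ ⊆? ∁ γ))
    ≡⟨ subsets-of-size (∁ γ) (n ∸ i) ⟩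
  + (∣ ∁ γ ∣ C (n ∸ i)) ∎
  where
  size-∁ : ∀ σ → 𝟙 (∣ σ ∣ ≟ i) ≡ 𝟙 (∣ ∁ σ ∣ ≟ n ∸ i)
  size-∁ σ = 𝟙-⇔ (λ { refl → ∣∁p∣≡n∸∣p∣ σ })
                 (λ eq → ℕP.∸-cancelˡ-≡ (∣p∣≤n σ) i≤n (trans (sym (∣∁p∣≡n∸∣p∣ σ)) eq))
                 (∣ σ ∣ ≟ i) (∣ ∁ σ ∣ ≟ n ∸ i)

  inclusion-∁ : ∀ σ → 𝟙 (γ ⊆? σ) ≡ 𝟙 (∁ σ ⊆? ∁ γ)
  inclusion-∁ σ = 𝟙-⇔ p⊆q⇒∁p⊇∁q ∁p⊆∁q⇒p⊇q (γ ⊆? σ) (∁ σ ⊆? ∁ γ)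

delta-subst : ∀ (c : ℕ → ℤ) {k e} (k≟e : Dec (k ≡ e)) → c e ℤ.* 𝟙 k≟e ≡ c k ℤ.* 𝟙 k≟e
delta-subst c         (yes refl) = refl
delta-subst c {k} {e} (no _)     = trans (ℤP.*-zeroʳ (c e)) (sym (ℤP.*-zeroʳ (c k)))

𝟙-<-suc : ∀ k e → 𝟙 (k <? suc e) ≡ 𝟙 (k <? e) ℤ.+ 𝟙 (k ≟ e)
𝟙-<-suc k e with ℕP.<-cmp k e
... | tri< k<e k≢e _ = trans (𝟙-yes (ℕP.m<n⇒m<1+n k<e) (k <? suc e))
                             (sym (cong₂ ℤ._+_ (𝟙-yes k<e (k <? e)) (𝟙-no k≢e (k ≟ e))))
... | tri≈ k≮e refl _ = trans (𝟙-yes (ℕP.n<1+n k) (k <? suc k))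
                              (sym (cong₂ ℤ._+_ (𝟙-no k≮e (k <? k)) (𝟙-yes refl (k ≟ k))))
... | tri> k≮e k≢e e<k = trans (𝟙-no (ℕP.<⇒≱ e<k ∘ ℕP.≤-pred) (k <? suc e))
                               (sym (cong₂ ℤ._+_ (𝟙-no k≮e (k <? e)) (𝟙-no k≢e (k ≟ e))))

∑-interval-delta : ∀ (c : ℕ → ℤ) s → (∀ j → j < s → c j ≡ + 0) → ∀ m k →
  ∑ (applyUpTo (s ℕ.+_) m) (λ j → c j ℤ.* 𝟙 (k ≟ j)) ≡ c k ℤ.* 𝟙 (k <? s ℕ.+ m)
∑-interval-delta c s c<s≡0 zero k = sym (below-s (k <? s ℕ.+ 0))
  where
  below-s : (k<s? : Dec (k < s ℕ.+ 0)) → c k ℤ.* 𝟙 k<s? ≡ + 0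
  below-s (yes k<s) = cong (ℤ._* + 1) (c<s≡0 k (subst (k <_) (ℕP.+-identityʳ s) k<s))
  below-s (no _)    = ℤP.*-zeroʳ (c k)
∑-interval-delta c s c<s≡0 (suc m) k = begin
  ∑ (applyUpTo (s ℕ.+_) (suc m)) term
    ≡⟨ cong (λ js → ∑ js term) (applyUpTo-∷ʳ (s ℕ.+_) m) ⟨
  ∑ (applyUpTo (s ℕ.+_) m ∷ʳ e) term
    ≡⟨ ∑-∷ʳ (applyUpTo (s ℕ.+_) m) e term ⟩
  ∑ (applyUpTo (s ℕ.+_) m) term ℤ.+ c e ℤ.* 𝟙 (k ≟ e)
    ≡⟨ cong₂ ℤ._+_ (∑-interval-delta c s c<s≡0 m k) (delta-subst c (k ≟ e)) ⟩
  c k ℤ.* 𝟙 (k <? e) ℤ.+ c k ℤ.* 𝟙 (k ≟ e)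
    ≡⟨ ℤP.*-distribˡ-+ (c k) (𝟙 (k <? e)) _ ⟨
  c k ℤ.* (𝟙 (k <? e) ℤ.+ 𝟙 (k ≟ e))
    ≡⟨ cong (c k ℤ.*_) (𝟙-<-suc k e) ⟨
  c k ℤ.* 𝟙 (k <? suc e)
    ≡⟨ cong (λ t → c k ℤ.* 𝟙 (k <? t)) (ℕP.+-suc s m) ⟨
  c k ℤ.* 𝟙 (k <? s ℕ.+ suc m) ∎
  where
  e : ℕ
  e = s ℕ.+ m

  term : ℕ → ℤ
  term j = c j ℤ.* 𝟙 (k ≟ j)

sgn-+ : ∀ a b → sgn (a ℕ.+ b) ≡ sgn a ℤ.* sgn b
sgn-+ zero    b = sym (ℤP.*-identityˡ _)
sgn-+ (suc a) b = trans (cong -_ (sgn-+ a b)) (ℤP.neg-distribˡ-* (sgn a) (sgn b))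

sgn-double : ∀ a → sgn (a ℕ.+ a) ≡ + 1
sgn-double zero    = refl
sgn-double (suc a) = begin
  - sgn (a ℕ.+ suc a)    ≡⟨ cong (λ t → - sgn t) (ℕP.+-suc a a) ⟩
  - - sgn (a ℕ.+ a)      ≡⟨ ℤP.neg-involutive _ ⟩
  sgn (a ℕ.+ a)          ≡⟨ sgn-double a ⟩
  + 1                    ∎

-- (-1)^{i + |E∖γ| + n} = (-1)^{i + |γ|}, because n = |E∖γ| + |γ|
sgn-∁ : ∀ {n} i (γ : Subset n) → sgn (i ℕ.+ ∣ ∁ γ ∣ ℕ.+ n) ≡ sgn i ℤ.* sgn ∣ γ ∣
sgn-∁ {n} i γ = begin
  sgn (i ℕ.+ ∣ ∁ γ ∣ ℕ.+ n)
    ≡⟨ cong (λ t → sgn (i ℕ.+ ∣ ∁ γ ∣ ℕ.+ t)) (sym split) ⟩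
  sgn (i ℕ.+ ∣ ∁ γ ∣ ℕ.+ (∣ ∁ γ ∣ ℕ.+ ∣ γ ∣))
    ≡⟨ cong sgn (regroup i ∣ ∁ γ ∣ ∣ γ ∣) ⟩
  sgn ((i ℕ.+ ∣ γ ∣) ℕ.+ (∣ ∁ γ ∣ ℕ.+ ∣ ∁ γ ∣))
    ≡⟨ sgn-+ (i ℕ.+ ∣ γ ∣) _ ⟩
  sgn (i ℕ.+ ∣ γ ∣) ℤ.* sgn (∣ ∁ γ ∣ ℕ.+ ∣ ∁ γ ∣)
    ≡⟨ cong₂ ℤ._*_ (sgn-+ i ∣ γ ∣) (sgn-double ∣ ∁ γ ∣) ⟩
  sgn i ℤ.* sgn ∣ γ ∣ ℤ.* + 1
    ≡⟨ ℤP.*-identityʳ _ ⟩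
  sgn i ℤ.* sgn ∣ γ ∣ ∎
  where
  split : ∣ ∁ γ ∣ ℕ.+ ∣ γ ∣ ≡ n
  split = trans (cong (ℕ._+ ∣ γ ∣) (∣∁p∣≡n∸∣p∣ γ)) (ℕP.m∸n+n≡m (∣p∣≤n γ))

  regroup : ∀ a b c → a ℕ.+ b ℕ.+ (b ℕ.+ c) ≡ (a ℕ.+ c) ℕ.+ (b ℕ.+ b)
  regroup = ℕSolver.solve-∀

module Coefficients {n : ℕ} (M : Matroid n) (d : ℕ) where

  𝒫 : List (Subset n)
  𝒫 = allSubsets n

  z : Subset n → ℤ
  z γ = Z^ (nullity M γ) d

  c : ℕ → ℕ → ℤ
  c i j = sgn (i ℕ.+ j ℕ.+ n) ℤ.* + (j C (n ∸ i))

  -- both sides equal ∑_γ c i |E∖γ| · [Z^d] Z^{n_M(γ)}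
  common : ℕ → ℤ
  common i = ∑ 𝒫 (λ γ → c i ∣ ∁ γ ∣ ℤ.* z γ)

  weight : ℕ → ℤ
  weight i = sgn i ℤ.* ∑ 𝒫 (λ σ → 𝟙 (∣ σ ∣ ≟ i) ℤ.* ∑ 𝒫 (λ γ → 𝟙 (γ ⊆? σ) ℤ.* (sgn ∣ γ ∣ ℤ.* z γ)))

  -- P_{M,i} is this double sum for every i; for i = 0 only σ = γ = ∅
  -- contribute, and n_M(∅) = 0.
  P-weight : ∀ i → P M i d ≡ weight i
  P-weight zero = sym (begin
    + 1 ℤ.* ∑ 𝒫 (λ σ → 𝟙 (∣ σ ∣ ≟ 0) ℤ.* ∑ 𝒫 (λ γ → 𝟙 (γ ⊆? σ) ℤ.* (sgn ∣ γ ∣ ℤ.* z γ)))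
      ≡⟨ ℤP.*-identityˡ _ ⟩
    ∑ 𝒫 (λ σ → 𝟙 (∣ σ ∣ ≟ 0) ℤ.* ∑ 𝒫 (λ γ → 𝟙 (γ ⊆? σ) ℤ.* (sgn ∣ γ ∣ ℤ.* z γ)))
      ≡⟨ ∑-size-zero n _ ⟩
    ∑ 𝒫 (λ γ → 𝟙 (γ ⊆? ⊥) ℤ.* (sgn ∣ γ ∣ ℤ.* z γ))
      ≡⟨ ∑-⊆⊥ n _ ⟩
    sgn ∣ ⊥ {n} ∣ ℤ.* Z^ (∣ ⊥ {n} ∣ ∸ rank M ⊥) d
      ≡⟨ cong (λ k → sgn k ℤ.* Z^ (k ∸ rank M ⊥) d) (∣⊥∣≡0 n) ⟩
    + 1 ℤ.* Z^ (0 ∸ rank M ⊥) d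
      ≡⟨ ℤP.*-identityˡ _ ⟩
    Z^ (0 ∸ rank M ⊥) d
      ≡⟨ cong (λ k → Z^ k d) (ℕP.0∸n≡0 (rank M ⊥)) ⟩
    Z^ 0 d
      ≡⟨ Z^0≡1 d ⟩
    1ₚ d ∎)
    where
    Z^0≡1 : ∀ e → Z^ 0 e ≡ 1ₚ e
    Z^0≡1 zero    = refl
    Z^0≡1 (suc e) = refl
  P-weight (suc j) = cong (sgn (suc j) ℤ.*_) (begin
    sumₚ (map (λ σ → sumₚ (map (λ γ → sgn ∣ γ ∣ ·ₚ Z^ (nullity M γ)) (subsetsOf σ)))
              (subsetsOfSize n (suc j))) d
      ≡⟨ coeff-∑-filter (λ σ → ∣ σ ∣ ≟ suc j) 𝒫 _ d ⟩
    ∑ 𝒫 (λ σ → 𝟙 (∣ σ ∣ ≟ suc j) ℤ.*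
               sumₚ (map (λ γ → sgn ∣ γ ∣ ·ₚ Z^ (nullity M γ)) (subsetsOf σ)) d)
      ≡⟨ ∑-cong 𝒫 (λ σ → cong (𝟙 (∣ σ ∣ ≟ suc j) ℤ.*_) (coeff-∑-filter (_⊆? σ) 𝒫 _ d)) ⟩
    ∑ 𝒫 (λ σ → 𝟙 (∣ σ ∣ ≟ suc j) ℤ.* ∑ 𝒫 (λ γ → 𝟙 (γ ⊆? σ) ℤ.* (sgn ∣ γ ∣ ℤ.* z γ))) ∎)

  -- exchanging the sums turns the inner count into C(|E∖γ|, n-i)
  weight-common : ∀ i → i ≤ n → weight i ≡ common i
  weight-common i i≤n = begin
    sgn i ℤ.* ∑ 𝒫 (λ σ → 𝟙 (∣ σ ∣ ≟ i) ℤ.* ∑ 𝒫 (λ γ → 𝟙 (γ ⊆? σ) ℤ.* (sgn ∣ γ ∣ ℤ.* z γ)))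
      ≡⟨ cong (sgn i ℤ.*_) (∑-exchange 𝒫 𝒫 (λ σ → 𝟙 (∣ σ ∣ ≟ i)) (λ σ γ → 𝟙 (γ ⊆? σ))
                                                 (λ γ → sgn ∣ γ ∣ ℤ.* z γ)) ⟩
    sgn i ℤ.* ∑ 𝒫 (λ γ → ∑ 𝒫 (λ σ → 𝟙 (∣ σ ∣ ≟ i) ℤ.* 𝟙 (γ ⊆? σ)) ℤ.* (sgn ∣ γ ∣ ℤ.* z γ))
      ≡⟨ cong (sgn i ℤ.*_) (∑-cong 𝒫 (λ γ → cong (ℤ._* (sgn ∣ γ ∣ ℤ.* z γ))
                                                 (supersets-of-size γ i i≤n))) ⟩
    sgn i ℤ.* ∑ 𝒫 (λ γ → + (∣ ∁ γ ∣ C (n ∸ i)) ℤ.* (sgn ∣ γ ∣ ℤ.* z γ))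
      ≡⟨ ∑-*ˡ 𝒫 (sgn i) _ ⟨
    ∑ 𝒫 (λ γ → sgn i ℤ.* (+ (∣ ∁ γ ∣ C (n ∸ i)) ℤ.* (sgn ∣ γ ∣ ℤ.* z γ)))
      ≡⟨ ∑-cong 𝒫 signs ⟩
    common i ∎
    where
    rearrange : ∀ a b k x → a ℤ.* (k ℤ.* (b ℤ.* x)) ≡ a ℤ.* b ℤ.* k ℤ.* x
    rearrange = ℤSolver.solve-∀

    signs : ∀ γ → sgn i ℤ.* (+ (∣ ∁ γ ∣ C (n ∸ i)) ℤ.* (sgn ∣ γ ∣ ℤ.* z γ)) ≡ c i ∣ ∁ γ ∣ ℤ.* z γ
    signs γ = trans (rearrange (sgn i) (sgn ∣ γ ∣) _ (z γ))
                    (cong (λ t → t ℤ.* + (∣ ∁ γ ∣ C (n ∸ i)) ℤ.* z γ) (sym (sgn-∁ i γ)))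

  -- exchanging the sums on the right, the sum over j ∈ [n-i, n] collapses
  -- to the single term j = |γ|; then reindex γ ↦ E∖γ.
  RHS-common : ∀ i → i ≤ n → RHS M i d ≡ common i
  RHS-common i i≤n = begin
    sumₚ (map (λ j → c i j ·ₚ sumₚ (map (λ γ → Z^ (nullity M (∁ γ))) (subsetsOfSize n j))) range) d
      ≡⟨ coeff-∑ range (λ j → c i j ·ₚ sumₚ (map (λ γ → Z^ (nullity M (∁ γ))) (subsetsOfSize n j))) d ⟩
    ∑ range (λ j → c i j ℤ.* sumₚ (map (λ γ → Z^ (nullity M (∁ γ))) (subsetsOfSize n j)) d)
      ≡⟨ ∑-cong range (λ j → cong (c i j ℤ.*_) (coeff-∑-filter (λ γ → ∣ γ ∣ ≟ j) 𝒫 _ d)) ⟩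
    ∑ range (λ j → c i j ℤ.* ∑ 𝒫 (λ γ → 𝟙 (∣ γ ∣ ≟ j) ℤ.* z (∁ γ)))
      ≡⟨ ∑-exchange range 𝒫 (c i) (λ j γ → 𝟙 (∣ γ ∣ ≟ j)) (z ∘ ∁) ⟩
    ∑ 𝒫 (λ γ → ∑ range (λ j → c i j ℤ.* 𝟙 (∣ γ ∣ ≟ j)) ℤ.* z (∁ γ))
      ≡⟨ ∑-cong 𝒫 (λ γ → cong (ℤ._* z (∁ γ)) (collapse γ)) ⟩
    ∑ 𝒫 (λ γ → c i ∣ γ ∣ ℤ.* z (∁ γ))
      ≡⟨ ∑-∁ n (λ γ → c i ∣ γ ∣ ℤ.* z (∁ γ)) ⟨
    ∑ 𝒫 (λ γ → c i ∣ ∁ γ ∣ ℤ.* z (∁ (∁ γ)))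
      ≡⟨ ∑-cong 𝒫 (λ γ → cong (λ τ → c i ∣ ∁ γ ∣ ℤ.* z τ) (∁-involutive γ)) ⟩
    common i ∎
    where
    range : List ℕ
    range = applyUpTo ((n ∸ i) ℕ.+_) (suc i)

    vanishes : ∀ j → j < n ∸ i → c i j ≡ + 0
    vanishes j j<n-i = trans (cong (λ t → sgn (i ℕ.+ j ℕ.+ n) ℤ.* + t) (k>n⇒nCk≡0 j<n-i))
                             (ℤP.*-zeroʳ (sgn (i ℕ.+ j ℕ.+ n)))

    -- every size |γ| ≤ n lies below the top n + 1 of the range
    collapse : ∀ γ → ∑ range (λ j → c i j ℤ.* 𝟙 (∣ γ ∣ ≟ j)) ≡ c i ∣ γ ∣
    collapse γ = begin
      ∑ range (λ j → c i j ℤ.* 𝟙 (∣ γ ∣ ≟ j))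
        ≡⟨ ∑-interval-delta (c i) (n ∸ i) vanishes (suc i) ∣ γ ∣ ⟩
      c i ∣ γ ∣ ℤ.* 𝟙 (∣ γ ∣ <? (n ∸ i) ℕ.+ suc i)
        ≡⟨ cong (c i ∣ γ ∣ ℤ.*_) (𝟙-yes below (∣ γ ∣ <? (n ∸ i) ℕ.+ suc i)) ⟩
      c i ∣ γ ∣ ℤ.* + 1
        ≡⟨ ℤP.*-identityʳ _ ⟩
      c i ∣ γ ∣ ∎
      where
      top : (n ∸ i) ℕ.+ suc i ≡ suc n
      top = trans (ℕP.+-suc (n ∸ i) i) (cong suc (ℕP.m∸n+n≡m i≤n))

      below : ∣ γ ∣ < (n ∸ i) ℕ.+ suc i
      below = subst (∣ γ ∣ <_) (sym top) (ℕ.s≤s (∣p∣≤n γ))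

proposition3 : (n : ℕ) (M : Matroid n) (i : ℕ) → i ≤ n → P M i ≈ₚ RHS M i
proposition3 n M i i≤n d = begin
  P M i d      ≡⟨ P-weight i ⟩
  weight i     ≡⟨ weight-common i i≤n ⟩
  common i     ≡⟨ RHS-common i i≤n ⟨
  RHS M i d    ∎
  where open Coefficients M d
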